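{- There exist binary strings $T_m$ ($m=2,3,\dots$) and, for each $m$, an LZSE factorization $\mathcal{G}_m$ of $T_m$ such that the ratio of the number of factors of the greedy LZSE factorization of $T_m$ to the number of factors of $\mathcal{G}_m$ tends to $2$ as $m\to\infty$.
   Context: An LZSE factorization of $T$ is a sequence of non-empty strings $F_1,\dots,F_f$ with $T=F_1\cdots F_f$, each either a char factor (a single character at its first occurrence in $T$) or a copy factor $F_i=F_l\cdots F_r$ for some $1\le l\le r<i$. The greedy LZSE factorization scans $T$ left to right, at each step taking a char factor if the next character is new, and otherwise the longest prefix of the remaining suffix equal to a concatenation $F_l\cdots F_r$ of consecutive already chosen factors. -}

module Defs where

open import Data.Bool using (Bool; true; false; _∧_; _∨_; not; if_then_else_)
open import Data.Nat using (ℕ; zero; suc; _+_; _*_; _∸_; _≤_; _<_; _<ᵇ_; ∣_-_∣)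
open import Data.List using (List; []; _∷_; _++_; [_]; length; take; drop; concat; upTo; concatMap; map)
open import Data.List.Membership.Propositional using (_∈_)
open import Data.Product using (Σ; ∃; ∃-syntax; _×_; _,_)
open import Data.Sum using (_⊎_)
open import Relation.Nullary using (¬_)
open import Relation.Binary.PropositionalEquality using (_≡_)

Str : Set
Str = List Bool

Fact : Set
Fact = List Str

-- Concatenation F_l ⋯ F_r of consecutive factors, 0-indexed: l ≤ r.
segment : Fact → ℕ → ℕ → Str
segment prev l r = concat (take (suc r ∸ l) (drop l prev))

CharFactor : Fact → Str → Set
CharFactor prev F = Σ Bool λ c → (F ≡ [ c ]) × ¬ (c ∈ concat prev)

CopyFactor : Fact → Str → Set
CopyFactor prev F = Σ ℕ λ l → Σ ℕ λ r → (l ≤ r) × (r < length prev) × (F ≡ segment prev l r)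

NonEmpty : Str → Set
NonEmpty F = Σ Bool λ c → Σ Str λ w → F ≡ c ∷ w

data LZ : Fact → Fact → Set where
  done : ∀ {prev} → LZ prev []
  next : ∀ {prev F Fs} → NonEmpty F → (CharFactor prev F ⊎ CopyFactor prev F)
       → LZ (prev ++ [ F ]) Fs → LZ prev (F ∷ Fs)

IsLZSE : Str → Fact → Set
IsLZSE T Fs = (concat Fs ≡ T) × LZ [] Fs

eqB : Bool → Bool → Bool
eqB true true = true
eqB false false = true
eqB _ _ = false

elemB : Bool → Str → Bool
elemB c [] = false
elemB c (x ∷ xs) = eqB c x ∨ elemB c xs

isPrefix : Str → Str → Bool
isPrefix [] _ = true
isPrefix (x ∷ xs) [] = false
isPrefix (x ∷ xs) (y ∷ ys) = eqB x y ∧ isPrefix xs ys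

segments : Fact → List Str
segments prev =
  concatMap (λ l → map (λ d → segment prev l (l + d)) (upTo (length prev ∸ l)))
            (upTo (length prev))

-- longest candidate that is a prefix of rem (or [] if none)
longestPrefix : List Str → Str → Str
longestPrefix [] rem = []
longestPrefix (s ∷ ss) rem with longestPrefix ss rem
... | b = if isPrefix s rem ∧ (length b <ᵇ length s) then s else b

-- fuel-driven scan; fuel = length T suffices since each step consumes ≥ 1 char
greedyGo : ℕ → Fact → Str → Fact
greedyGo zero prev rem = []
greedyGo (suc n) prev [] = []
greedyGo (suc n) prev (c ∷ rest) =
  if not (elemB c (concat prev))
  then [ c ] ∷ greedyGo n (prev ++ [ [ c ] ]) rest
  else step (longestPrefix (segments prev) (c ∷ rest))
  where
    step : Str → Fact
    step [] = [ c ] ∷ greedyGo n (prev ++ [ [ c ] ]) rest   -- unreachable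
    step F@(_ ∷ _) = F ∷ greedyGo n (prev ++ [ F ]) (drop (length F) (c ∷ rest))

greedy : Str → Fact
greedy T = greedyGo (length T) [] T

-- a m / b m → 2 as m → ∞ (rationally): for every k ≥ 1 there is N with
-- |a m / b m − 2| < 1/k for all m ≥ N, i.e. |k·a m − 2k·b m| < b m
-- (which also forces b m > 0).
RatioTendsTo2 : (ℕ → ℕ) → (ℕ → ℕ) → Set
RatioTendsTo2 a b = ∀ k → 1 ≤ k → Σ ℕ λ N → ∀ m → N ≤ m →
  ∣ k * a m - 2 * k * b m ∣ < b m

{-# OPTIONS --safe #-}
-- Tₘ = 1 0^(13·2^m) 1 0^(13·2^(m−1)) ⋯ 1 0^13.  A short factorization spells 1 0^13 with the seven factors
-- 1, 0, 0, 0, 0³, 0⁶, 0, then takes 0^(13·2^i) for i < m, each a copy of all zero factors before it, and copies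
-- every later block 1 0^(13·2^s) as the first 7 + s factors: 2m + 7 factors.
-- Greedy instead doubles: after 1, 0 it takes 0, 0², 0⁴, …, 0^(4·2^m), then 0^(4·2^m) and 0^(2^m), and it splits
-- every later block as 1 0^(8p), 0^(4p), 0^p with p = 2^s: 4m + 7 factors.  That each of these copies is the
-- longest one available is arithmetic on runs of consecutive earlier factors: runs of consecutive doubling factors
-- have lengths 2^b − 2^a, none of which lies in (4p, 5p]; no power of two lies in (8p, 13p]; and the zeros of a
-- run that continues with a 1 never exactly fill the zeros still to be read.
module Submission where

open import Defs
open import Data.Bool using (true; false; T)
open import Data.Nat using (ℕ; zero; suc; _+_; _*_; _∸_; _≤_; _<_; _^_; z≤n; s≤s; _<ᵇ_; ∣_-_∣)
open import Data.Nat.Properties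
open import Data.List using (List; []; _∷_; _++_; [_]; length; take; drop; concat; upTo; concatMap; map; replicate; tails)
open import Data.List.Properties
  using ( ∷-injective; map-++; length-map; length-++; take-map; drop-map; length-replicate; concat-++; ++-assoc
        ; ++-identityʳ; concatMap-++; take++drop≡id)
open import Data.List.Membership.Propositional using (_∈_; find; lose)
open import Data.List.Membership.Propositional.Properties using (∈-concatMap⁺; ∈-concatMap⁻; ∈-upTo⁺; ∈-map⁺; ∈-map⁻)
open import Data.List.Relation.Unary.Any using (here; there)
open import Data.List.Relation.Unary.All as All using (All; []; _∷_)
import Data.List.Relation.Unary.All.Properties as All
open import Data.Product using (Σ; ∃; ∃₂; _×_; _,_; proj₁; proj₂)
open import Data.Sum using (_⊎_; inj₁; inj₂; [_,_]′; map₂)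
open import Data.Empty using (⊥-elim)
open import Data.Unit using (⊤; tt)
open import Relation.Binary.PropositionalEquality hiding ([_])
open import Relation.Nullary using (¬_; contradiction; yes; no)
open import Relation.Binary.Definitions using (tri<; tri≈; tri>)
open import Function using (_∘_)
open import Data.Nat.Tactic.RingSolver using (solve-∀)

infix 4 _≼_
_≼_ : Str → Str → Set
u ≼ v = ∃ λ w → u ++ w ≡ v

eqB⇒≡ : ∀ x y → eqB x y ≡ true → x ≡ y
eqB⇒≡ true true _ = refl
eqB⇒≡ false false _ = refl

eqB-refl : ∀ x → eqB x x ≡ true
eqB-refl true = refl
eqB-refl false = refl

isPrefix⇒≼ : ∀ u v → isPrefix u v ≡ true → u ≼ v
isPrefix⇒≼ [] v _ = v , refl
isPrefix⇒≼ (x ∷ u) (y ∷ v) e with eqB x y in x≟y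
... | true with isPrefix⇒≼ u v e
...   | w , refl rewrite eqB⇒≡ x y x≟y = w , refl

≼⇒isPrefix : ∀ u v → u ≼ v → isPrefix u v ≡ true
≼⇒isPrefix [] v _ = refl
≼⇒isPrefix (x ∷ u) .(x ∷ u ++ w) (w , refl) rewrite eqB-refl x = ≼⇒isPrefix u (u ++ w) (w , refl)

≼-unique : ∀ u u' v → u ≼ v → u' ≼ v → length u ≡ length u' → u ≡ u'
≼-unique [] [] v _ _ _ = refl
≼-unique (x ∷ u) (x' ∷ u') .(x ∷ u ++ w) (w , refl) (w' , e') len with ∷-injective e'
... | refl , e'' = cong (x ∷_) (≼-unique u u' (u ++ w) (w , refl) (w' , e'') (suc-injective len))

longestPrefix-∈ : ∀ ss rem →
  longestPrefix ss rem ≡ [] ⊎ (longestPrefix ss rem ∈ ss × isPrefix (longestPrefix ss rem) rem ≡ true)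
longestPrefix-∈ [] rem = inj₁ refl
longestPrefix-∈ (s ∷ ss) rem with longestPrefix ss rem | longestPrefix-∈ ss rem
... | b | ih with isPrefix s rem in s≼rem | length b <ᵇ length s
... | true  | true  = inj₂ (here refl , s≼rem)
... | true  | false = map₂ (λ (m , e) → there m , e) ih
... | false | _     = map₂ (λ (m , e) → there m , e) ih

longestPrefix-maximal : ∀ ss rem {s} → s ∈ ss → isPrefix s rem ≡ true → length s ≤ length (longestPrefix ss rem)
longestPrefix-maximal (s ∷ ss) rem m s≼rem with longestPrefix ss rem | longestPrefix-maximal ss rem
... | b | ih with isPrefix s rem in s'≼rem | length b <ᵇ length s in b<s | m
... | true  | true  | here refl = ≤-refl
... | true  | true  | there m'  = <⇒≤ (≤-<-trans (ih m' s≼rem) (<ᵇ⇒< (length b) (length s) (subst T (sym b<s) tt)))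
... | true  | false | here refl = ≮⇒≥ (λ lt → subst T b<s (<⇒<ᵇ lt))
... | true  | false | there m'  = ih m' s≼rem
... | false | _     | here refl = contradiction (trans (sym s≼rem) s'≼rem) λ ()
... | false | _     | there m'  = ih m' s≼rem

longestPrefix≡ : ∀ {ss rem F} → F ∈ ss → F ≼ rem → (∀ {s} → s ∈ ss → s ≼ rem → length s ≤ length F)
               → 1 ≤ length F → longestPrefix ss rem ≡ F
longestPrefix≡ {ss} {rem} {F} F∈ss F≼rem F-max 1≤|F| = [ empty , found ]′ (longestPrefix-∈ ss rem)
  where
  F≤b : length F ≤ length (longestPrefix ss rem)
  F≤b = longestPrefix-maximal ss rem F∈ss (≼⇒isPrefix F rem F≼rem)
  empty : longestPrefix ss rem ≡ [] → longestPrefix ss rem ≡ F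
  empty b≡[] = contradiction (subst (λ b → length F ≤ length b) b≡[] F≤b) (<⇒≱ 1≤|F|)
  found : longestPrefix ss rem ∈ ss × isPrefix (longestPrefix ss rem) rem ≡ true → longestPrefix ss rem ≡ F
  found (b∈ss , b≼rem) = ≼-unique _ F rem b≼rem' F≼rem (≤-antisym (F-max b∈ss b≼rem') F≤b)
    where b≼rem' = isPrefix⇒≼ _ rem b≼rem

segment∈segments : ∀ prev {l r} → l ≤ r → r < length prev → segment prev l r ∈ segments prev
segment∈segments prev {l} {r} l≤r r<n =
  ∈-concatMap⁺ row {xs = upTo (length prev)}
    (lose (∈-upTo⁺ (≤-<-trans l≤r r<n))
      (subst (λ r' → segment prev l r' ∈ row l) (m+[n∸m]≡n l≤r) (∈-map⁺ _ (∈-upTo⁺ (∸-monoˡ-< r<n l≤r)))))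
  where row = λ l → map (λ d → segment prev l (l + d)) (upTo (length prev ∸ l))

∈segments⇒segment : ∀ prev {s} → s ∈ segments prev → ∃₂ λ l d → s ≡ segment prev l (l + d)
∈segments⇒segment prev s∈ with find (∈-concatMap⁻ _ {xs = upTo (length prev)} s∈)
... | l , _ , s∈row with ∈-map⁻ _ s∈row
...   | d , _ , s≡ = l , d , s≡

copyFactor∈segments : ∀ {prev F} → CopyFactor prev F → F ∈ segments prev
copyFactor∈segments {prev} (l , r , l≤r , r<n , refl) = segment∈segments prev l≤r r<n

record GreedyLength (prev : Fact) (rem : Str) (k : ℕ) : Set where
  constructor counted
  field factorCount : ∀ n → length rem ≤ n → length (greedyGo n prev rem) ≡ k
open GreedyLength

greedyLength-[] : ∀ {prev} → GreedyLength prev [] 0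
greedyLength-[] = counted λ { zero _ → refl ; (suc n) _ → refl }

greedyLength-char : ∀ {prev c rest k} → elemB c (concat prev) ≡ false
                  → GreedyLength (prev ++ [ [ c ] ]) rest k → GreedyLength prev (c ∷ rest) (suc k)
greedyLength-char {prev} {c} {rest} {k} new run = counted count
  where
  count : ∀ n → length (c ∷ rest) ≤ n → length (greedyGo n prev (c ∷ rest)) ≡ suc k
  count (suc n) (s≤s le) rewrite new = cong suc (factorCount run n le)

drop-length-++ : ∀ (u v : Str) → drop (length u) (u ++ v) ≡ v
drop-length-++ [] v = refl
drop-length-++ (x ∷ u) v = drop-length-++ u v

greedyLength-copy : ∀ {prev c w rem k} → elemB c (concat prev) ≡ true → CopyFactor prev (c ∷ w)
  → (∀ {s} → s ∈ segments prev → s ≼ c ∷ w ++ rem → length s ≤ suc (length w))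
  → GreedyLength (prev ++ [ c ∷ w ]) rem k → GreedyLength prev (c ∷ w ++ rem) (suc k)
greedyLength-copy {prev} {c} {w} {rem} {k} old copy maximal run = counted count
  where
  count : ∀ n → length (c ∷ w ++ rem) ≤ n → length (greedyGo n prev (c ∷ w ++ rem)) ≡ suc k
  count (suc n) (s≤s le)
    rewrite old | longestPrefix≡ (copyFactor∈segments copy) (rem , refl) maximal (s≤s z≤n) | drop-length-++ w rem =
    cong suc (factorCount run n (≤-trans (m≤n+m (length rem) (length w)) (subst (_≤ n) (length-++ w) le)))

0^_ : ℕ → Str
0^ n = replicate n false

data Piece : Set where
  zeros oneZeros : ℕ → Piece

⟦_⟧ : Piece → Str
⟦ zeros k ⟧ = 0^ k
⟦ oneZeros k ⟧ = true ∷ 0^ k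

factors : List Piece → Fact
factors = map ⟦_⟧

text : List Piece → Str
text ps = concat (factors ps)

0^-++ : ∀ a b w → 0^ a ++ 0^ b ++ w ≡ 0^ (a + b) ++ w
0^-++ zero b w = refl
0^-++ (suc a) b w = cong (false ∷_) (0^-++ a b w)

length-0^-++ : ∀ k w → length (0^ k ++ w) ≡ k + length w
length-0^-++ k w = trans (length-++ (0^ k)) (cong (_+ length w) (length-replicate k))

text-++ : ∀ ps qs → text (ps ++ qs) ≡ text ps ++ text qs
text-++ ps qs = trans (cong concat (map-++ ⟦_⟧ ps qs)) (sym (concat-++ (factors ps) (factors qs)))

segment-factors : ∀ ps l d → segment (factors ps) l (l + d) ≡ text (take (suc d) (drop l ps))
segment-factors ps l d
  rewrite sym (+-suc l d) | m+n∸m≡n l (suc d) | drop-map {f = ⟦_⟧} l ps | take-map {f = ⟦_⟧} (suc d) (drop l ps) = refl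

copyFactor-pieces : ∀ ps l d → l + d < length ps → CopyFactor (factors ps) (text (take (suc d) (drop l ps)))
copyFactor-pieces ps l d lt =
  l , l + d , m≤m+n l d , subst (l + d <_) (sym (length-map ⟦_⟧ ps)) lt , sym (segment-factors ps l d)

all-tails-drop : ∀ {A : Set} {P : List A → Set} {xs} → All P (tails xs) → ∀ l → P (drop l xs)
all-tails-drop {xs = []} (p ∷ []) zero = p
all-tails-drop {xs = []} (p ∷ []) (suc l) = p
all-tails-drop {xs = x ∷ xs} (p ∷ ps) zero = p
all-tails-drop {xs = x ∷ xs} (p ∷ ps) (suc l) = all-tails-drop ps l

PrefixesBounded : Str → ℕ → List Piece → Set
PrefixesBounded rem f ps = ∀ n → text (take n ps) ≼ rem → length (text (take n ps)) ≤ f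

prefixesBounded-mono : ∀ {rem f f' ps} → f ≤ f' → PrefixesBounded rem f ps → PrefixesBounded rem f' ps
prefixesBounded-mono f≤f' bounded n pre = ≤-trans (bounded n pre) f≤f'

length-text-take : ∀ n ps → length (text (take n ps)) ≤ length (text ps)
length-text-take n ps = begin
  length (text (take n ps))                              ≤⟨ m≤m+n _ _ ⟩
  length (text (take n ps)) + length (text (drop n ps))  ≡⟨ sym (length-++ (text (take n ps))) ⟩
  length (text (take n ps) ++ text (drop n ps))          ≡⟨ cong length (sym (text-++ (take n ps) (drop n ps))) ⟩
  length (text (take n ps ++ drop n ps))                 ≡⟨ cong (length ∘ text) (take++drop≡id n ps) ⟩
  length (text ps)                                       ∎
  where open ≤-Reasoning

prefixesBounded-total : ∀ rem ps → All (PrefixesBounded rem (length (text ps))) (tails ps)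
prefixesBounded-total rem [] = (λ n _ → length-text-take n []) ∷ []
prefixesBounded-total rem (p ∷ ps) =
  (λ n _ → length-text-take n (p ∷ ps))
  ∷ All.map (prefixesBounded-mono (subst (length (text ps) ≤_) (sym (length-++ ⟦ p ⟧)) (m≤n+m _ _)))
            (prefixesBounded-total rem ps)

segments-bounded : ∀ {ps rem f} → All (PrefixesBounded rem f) (tails ps)
                 → ∀ {s} → s ∈ segments (factors ps) → s ≼ rem → length s ≤ f
segments-bounded {ps} bounded s∈ s≼rem with ∈segments⇒segment (factors ps) s∈
... | l , d , refl rewrite segment-factors ps l d = all-tails-drop bounded l (suc d) s≼rem

greedyLength-zeros : ∀ {ps f rem k} → 1 ≤ f → elemB false (text ps) ≡ true → CopyFactor (factors ps) (0^ f)
  → All (PrefixesBounded (0^ f ++ rem) f) (tails ps)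
  → GreedyLength (factors (ps ++ [ zeros f ])) rem k → GreedyLength (factors ps) (0^ f ++ rem) (suc k)
greedyLength-zeros {ps} {suc f} _ old copy bounded run =
  greedyLength-copy old copy (segments-bounded (All.map (prefixesBounded-mono |0^f|) bounded))
    (subst (λ qs → GreedyLength qs _ _) (map-++ ⟦_⟧ ps _) run)
  where |0^f| = ≤-reflexive (cong suc (sym (length-replicate f)))

greedyLength-oneZeros : ∀ {ps f rem k} → elemB true (text ps) ≡ true → CopyFactor (factors ps) (true ∷ 0^ f)
  → All (PrefixesBounded (true ∷ 0^ f ++ rem) (suc f)) (tails ps)
  → GreedyLength (factors (ps ++ [ oneZeros f ])) rem k → GreedyLength (factors ps) (true ∷ 0^ f ++ rem) (suc k)
greedyLength-oneZeros {ps} {f} old copy bounded run =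
  greedyLength-copy old copy (segments-bounded (All.map (prefixesBounded-mono |0^f|) bounded))
    (subst (λ qs → GreedyLength qs _ _) (map-++ ⟦_⟧ ps _) run)
  where |0^f| = ≤-reflexive (cong suc (sym (length-replicate f)))

OneOrEmpty : Str → Set
OneOrEmpty z = z ≡ [] ⊎ ∃ λ z' → z ≡ true ∷ z'

0^-++-≼⇒≤ : ∀ a x w {z} → OneOrEmpty z → 0^ a ++ w ≼ 0^ x ++ z → a ≤ x
0^-++-≼⇒≤ zero x w _ _ = z≤n
0^-++-≼⇒≤ (suc a) zero w (inj₁ refl) (_ , ())
0^-++-≼⇒≤ (suc a) zero w (inj₂ (_ , refl)) (_ , ())
0^-++-≼⇒≤ (suc a) (suc x) w oz (v , e) = s≤s (0^-++-≼⇒≤ a x w oz (v , proj₂ (∷-injective e)))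

0^-++-1-≼⇒≡ : ∀ a x w {z} → OneOrEmpty z → 0^ a ++ true ∷ w ≼ 0^ x ++ z → a ≡ x
0^-++-1-≼⇒≡ zero zero w _ _ = refl
0^-++-1-≼⇒≡ (suc a) zero w (inj₁ refl) (_ , ())
0^-++-1-≼⇒≡ (suc a) zero w (inj₂ (_ , refl)) (_ , ())
0^-++-1-≼⇒≡ (suc a) (suc x) w oz (v , e) = cong suc (0^-++-1-≼⇒≡ a x w oz (v , proj₂ (∷-injective e)))

AvoidsGap : ℕ → ℕ → ℕ → Set
AvoidsGap f x a = a ≤ x → a ≤ f

avoidsGap-beyond : ∀ {f x a} → x < a → AvoidsGap f x a
avoidsGap-beyond x<a a≤x = contradiction a≤x (<⇒≱ x<a)

avoidsGap-≤ : ∀ {f x a} → x ≤ f → AvoidsGap f x a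
avoidsGap-≤ x≤f a≤x = ≤-trans a≤x x≤f

-- Ensures that a candidate matching 0^x 1⋯, with acc zeros already read, has length ≤ f: its zero run must
-- fit into 0^x, hence avoid (f, x], and it can continue with a 1 only after exactly x zeros.
Capped : ℕ → ℕ → ℕ → List Piece → Set
Capped f x acc [] = AvoidsGap f x acc
Capped f x acc (zeros k ∷ ps) = AvoidsGap f x acc × Capped f x (acc + k) ps
Capped f x acc (oneZeros _ ∷ _) = AvoidsGap f x acc × ¬ acc ≡ x

capped-avoidsGap : ∀ {f x acc} ps → Capped f x acc ps → AvoidsGap f x acc
capped-avoidsGap [] cap = cap
capped-avoidsGap (zeros _ ∷ _) (gap , _) = gap
capped-avoidsGap (oneZeros _ ∷ _) (gap , _) = gap

capped-beyond : ∀ {f x acc} ps → x < acc → Capped f x acc ps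
capped-beyond [] x<acc = avoidsGap-beyond x<acc
capped-beyond (zeros k ∷ ps) x<acc = avoidsGap-beyond x<acc , capped-beyond ps (<-≤-trans x<acc (m≤m+n _ k))
capped-beyond (oneZeros _ ∷ _) x<acc = avoidsGap-beyond x<acc , λ acc≡x → <⇒≢ x<acc (sym acc≡x)

capped-zeros : ∀ {f x acc k} ps → x ≤ f → x < acc + k → Capped f x acc (zeros k ∷ ps)
capped-zeros ps x≤f x< = avoidsGap-≤ x≤f , capped-beyond ps x<

capped-prefix-≤ : ∀ {f x z} → OneOrEmpty z → ∀ ps acc n → Capped f x acc ps
  → 0^ acc ++ text (take n ps) ≼ 0^ x ++ z → acc + length (text (take n ps)) ≤ f
capped-prefix-≤ {f} oz ps acc zero cap pre =
  subst (_≤ f) (sym (+-identityʳ acc)) (capped-avoidsGap ps cap (0^-++-≼⇒≤ acc _ [] oz pre))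
capped-prefix-≤ {f} oz [] acc (suc n) cap pre =
  subst (_≤ f) (sym (+-identityʳ acc)) (cap (0^-++-≼⇒≤ acc _ [] oz pre))
capped-prefix-≤ {f} oz (zeros k ∷ ps) acc (suc n) (_ , cap) pre =
  subst (_≤ f) (trans (+-assoc acc k _) (cong (acc +_) (sym (length-0^-++ k _))))
    (capped-prefix-≤ oz ps (acc + k) n cap (subst (_≼ _) (0^-++ acc k _) pre))
capped-prefix-≤ oz (oneZeros k ∷ ps) acc (suc n) (_ , acc≢x) pre = ⊥-elim (acc≢x (0^-++-1-≼⇒≡ acc _ _ oz pre))

Capped₀ : ℕ → ℕ → List Piece → Set
Capped₀ f x [] = ⊤
Capped₀ f x (zeros k ∷ ps) = Capped f x 0 (zeros k ∷ ps)
Capped₀ f x (oneZeros _ ∷ _) = ⊤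

Capped₁ : ℕ → ℕ → List Piece → Set
Capped₁ f x [] = ⊤
Capped₁ f x (zeros k ∷ _) = 1 ≤ k
Capped₁ f x (oneZeros k ∷ ps) = Capped f x k ps

capped₀⇒bounded : ∀ {f x z} → OneOrEmpty z → 1 ≤ x → ∀ ps → Capped₀ f x ps → PrefixesBounded (0^ x ++ z) f ps
capped₀⇒bounded _ _ [] _ zero _ = z≤n
capped₀⇒bounded _ _ [] _ (suc n) _ = z≤n
capped₀⇒bounded oz _ ps@(zeros _ ∷ _) cap n pre = capped-prefix-≤ oz ps 0 n cap pre
capped₀⇒bounded _ _ (oneZeros _ ∷ _) _ zero _ = z≤n
capped₀⇒bounded _ (s≤s _) (oneZeros _ ∷ _) _ (suc n) (_ , ())

capped₁⇒bounded : ∀ {f x z} → OneOrEmpty z → ∀ ps → Capped₁ f x ps → PrefixesBounded (true ∷ 0^ x ++ z) (suc f) ps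
capped₁⇒bounded _ [] _ zero _ = z≤n
capped₁⇒bounded _ [] _ (suc n) _ = z≤n
capped₁⇒bounded _ (zeros _ ∷ _) _ zero _ = z≤n
capped₁⇒bounded _ (zeros (suc _) ∷ _) _ (suc n) (_ , ())
capped₁⇒bounded _ (oneZeros _ ∷ _) _ zero _ = z≤n
capped₁⇒bounded {f} oz (oneZeros k ∷ ps) cap (suc n) (v , e) =
  s≤s (subst (_≤ f) (sym (length-0^-++ k _)) (capped-prefix-≤ oz ps k n cap (v , proj₂ (∷-injective e))))

capped₀⇒bounded-0^ : ∀ {f x z} → OneOrEmpty z → 1 ≤ f → ∀ {ps} → Capped₀ f (f + x) ps
                   → PrefixesBounded (0^ f ++ 0^ x ++ z) f ps
capped₀⇒bounded-0^ {f} {x} {z} oz 1≤f {ps} cap =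
  subst (λ rem → PrefixesBounded rem f ps) (sym (0^-++ f x z)) (capped₀⇒bounded oz (≤-trans 1≤f (m≤m+n f x)) ps cap)

capped₁⇒bounded-0^ : ∀ {f x z} → OneOrEmpty z → ∀ {ps} → Capped₁ f (f + x) ps
                   → PrefixesBounded (true ∷ 0^ f ++ 0^ x ++ z) (suc f) ps
capped₁⇒bounded-0^ {f} {x} {z} oz {ps} cap =
  subst (λ rem → PrefixesBounded rem (suc f) ps) (cong (true ∷_) (sym (0^-++ f x z))) (capped₁⇒bounded oz ps cap)

geometric : ℕ → ℕ → List Piece
geometric a zero = []
geometric a (suc c) = zeros a ∷ geometric (2 * a) c

length-geometric : ∀ a c → length (geometric a c) ≡ c
length-geometric a zero = refl
length-geometric a (suc c) = cong suc (length-geometric (2 * a) c)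

p*[2*a]≡2*p*a : ∀ p a → p * (2 * a) ≡ 2 * p * a
p*[2*a]≡2*p*a = solve-∀

text-geometric : ∀ a c → 0^ a ++ text (geometric a c) ≡ 0^ (2 ^ c * a)
text-geometric a zero = trans (++-identityʳ (0^ a)) (cong 0^_ (sym (*-identityˡ a)))
text-geometric a (suc c) = begin
  0^ a ++ 0^ a ++ text (geometric (2 * a) c)  ≡⟨ 0^-++ a a _ ⟩
  0^ (a + a) ++ text (geometric (2 * a) c)    ≡⟨ cong (λ n → 0^ n ++ text (geometric (2 * a) c)) (sym (2*n≡n+n a)) ⟩
  0^ (2 * a) ++ text (geometric (2 * a) c)    ≡⟨ text-geometric (2 * a) c ⟩
  0^ (2 ^ c * (2 * a))                        ≡⟨ cong 0^_ (p*[2*a]≡2*p*a (2 ^ c) a) ⟩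
  0^ (2 ^ suc c * a)                          ∎
  where
  open ≡-Reasoning
  2*n≡n+n : ∀ n → 2 * n ≡ n + n
  2*n≡n+n n = cong (n +_) (+-identityʳ n)

geometric-snoc : ∀ {b} a c → b ≡ 2 ^ c * a → geometric a c ++ [ zeros b ] ≡ geometric a (suc c)
geometric-snoc a zero refl = cong (λ n → [ zeros n ]) (*-identityˡ a)
geometric-snoc a (suc c) refl =
  cong (zeros a ∷_) (geometric-snoc (2 * a) c (sym (p*[2*a]≡2*p*a (2 ^ c) a)))

take-geometric : ∀ i d a r → take i (geometric a (i + d) ++ r) ≡ geometric a i
take-geometric zero d a r = refl
take-geometric (suc i) d a r = cong (zeros a ∷_) (take-geometric i d (2 * a) r)

text-take-geometric : ∀ {i c} a r → i ≤ c → 0^ a ++ text (take i (geometric a c ++ r)) ≡ 0^ (2 ^ i * a)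
text-take-geometric {i} {c} a r i≤c = begin
  0^ a ++ text (take i (geometric a c ++ r))
    ≡⟨ cong (λ c → 0^ a ++ text (take i (geometric a c ++ r))) (sym (m+[n∸m]≡n i≤c)) ⟩
  0^ a ++ text (take i (geometric a (i + (c ∸ i)) ++ r))
    ≡⟨ cong (λ ps → 0^ a ++ text ps) (take-geometric i (c ∸ i) a r) ⟩
  0^ a ++ text (geometric a i)
    ≡⟨ text-geometric a i ⟩
  0^ (2 ^ i * a)
    ∎
  where open ≡-Reasoning

all-tails-geometric : ∀ {P : List Piece → Set} {r} c i → (∀ c' i' → P (geometric (2 ^ i') (suc c') ++ r))
                    → All P (tails r) → All P (tails (geometric (2 ^ i) c ++ r))
all-tails-geometric zero i each rest = rest
all-tails-geometric (suc c) i each rest = each c i ∷ all-tails-geometric c (suc i) each rest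

capped-geometric : ∀ {f x} (P : ℕ → ℕ → Set) → (∀ {i a} → P i a → AvoidsGap f x a × P (suc i) (a + 2 ^ i))
  → ∀ c i {acc r} → P i acc → (∀ {a} → P (c + i) a → Capped f x a r) → Capped f x acc (geometric (2 ^ i) c ++ r)
capped-geometric P step zero i p end = end p
capped-geometric P step (suc c) i p end =
  proj₁ (step p) , capped-geometric P step c (suc i) (proj₂ (step p)) (λ {a} q → end (subst (λ j → P j a) (+-suc c i) q))

1≤2^ : ∀ i → 1 ≤ 2 ^ i
1≤2^ = m^n>0 2

2^suc≡2^+2^ : ∀ i → 2 ^ suc i ≡ 2 ^ i + 2 ^ i
2^suc≡2^+2^ i = cong (2 ^ i +_) (+-identityʳ (2 ^ i))

2^-mono-< : ∀ {i j} → i < j → 2 ^ i < 2 ^ j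
2^-mono-< = ^-monoʳ-< 2 (s≤s (s≤s z≤n))

2^<2^2+ : ∀ s → 2 ^ s < 2 ^ (2 + s)
2^<2^2+ s = 2^-mono-< (s≤s (n≤1+n s))

2^+<2^suc : ∀ k {m} → m < 2 ^ k → 2 ^ k + m < 2 ^ suc k
2^+<2^suc k {m} m< = subst (2 ^ k + m <_) (sym (2^suc≡2^+2^ k)) (+-monoʳ-< (2 ^ k) m<)

2^-avoidsGap : ∀ k {m} i → m < 2 ^ k → AvoidsGap (2 ^ k) (2 ^ k + m) (2 ^ i)
2^-avoidsGap k i m< with i ≤? k
... | yes i≤k = λ _ → ^-monoʳ-≤ 2 i≤k
... | no i≰k  = avoidsGap-beyond (<-≤-trans (2^+<2^suc k m<) (^-monoʳ-≤ 2 (≰⇒> i≰k)))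

2^≢2^+ : ∀ k {m} i → 0 < m → m < 2 ^ k → ¬ 2 ^ i ≡ 2 ^ k + m
2^≢2^+ k i 0<m m< eq = <⇒≱ (m<m+n (2 ^ k) 0<m) (subst (_≤ 2 ^ k) eq (2^-avoidsGap k i m< (≤-reflexive eq)))

-- A run of consecutive doubling pieces ending just before the piece 2^i is either empty or at least half of 2^i.
HalfFull : ℕ → ℕ → Set
HalfFull i a = a ≤ 2 ^ i × (a ≡ 0 ⊎ 2 ^ i ≤ a + a)

halfFull-step : ∀ {i a} → HalfFull i a → HalfFull (suc i) (a + 2 ^ i)
halfFull-step {i} {a} (a≤2^i , _) =
  subst (a + 2 ^ i ≤_) (sym (2^suc≡2^+2^ i)) (+-monoˡ-≤ (2 ^ i) a≤2^i) ,
  inj₂ (subst (_≤ (a + 2 ^ i) + (a + 2 ^ i)) (sym (2^suc≡2^+2^ i)) (+-mono-≤ (m≤n+m (2 ^ i) a) (m≤n+m (2 ^ i) a)))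

halfFull-avoidsGap : ∀ s {i a} → HalfFull i a → AvoidsGap (2 ^ (2 + s)) (2 ^ (2 + s) + 2 ^ s) (a + 2 ^ i)
halfFull-avoidsGap s {i} {a} (a≤2^i , half) with <-cmp i (2 + s)
... | tri< i<2+s _ _ = λ _ →
  ≤-trans (+-monoˡ-≤ (2 ^ i) a≤2^i) (≤-trans (≤-reflexive (sym (2^suc≡2^+2^ i))) (^-monoʳ-≤ 2 i<2+s))
... | tri> _ _ 2+s<i =
  avoidsGap-beyond (<-≤-trans (2^+<2^suc (2 + s) (2^<2^2+ s)) (≤-trans (^-monoʳ-≤ 2 2+s<i) (m≤n+m (2 ^ i) a)))
... | tri≈ _ refl _ with half
...   | inj₁ refl = λ _ → ≤-refl
...   | inj₂ 2^i≤a+a = λ le → contradiction 2^i≤a+a (<⇒≱ (begin-strict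
  a + a             ≤⟨ +-mono-≤ (a≤2^s le) (a≤2^s le) ⟩
  2 ^ s + 2 ^ s     ≡⟨ sym (2^suc≡2^+2^ s) ⟩
  2 ^ suc s         <⟨ 2^-mono-< {suc s} ≤-refl ⟩
  2 ^ (2 + s)       ∎))
  where
  open ≤-Reasoning
  a≤2^s : a + 2 ^ (2 + s) ≤ 2 ^ (2 + s) + 2 ^ s → a ≤ 2 ^ s
  a≤2^s le = +-cancelʳ-≤ (2 ^ (2 + s)) a (2 ^ s) (subst (a + 2 ^ (2 + s) ≤_) (+-comm (2 ^ (2 + s)) (2 ^ s)) le)

13*2^≡ : ∀ s → 13 * 2 ^ s ≡ 2 ^ (3 + s) + (2 ^ (2 + s) + 2 ^ s)
13*2^≡ s = lemma (2 ^ s)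
  where
  lemma : ∀ p → 13 * p ≡ 2 * (2 * (2 * p)) + (2 * (2 * p) + p)
  lemma = solve-∀

13*2^<2^4+ : ∀ s → 2 ^ (3 + s) + (2 ^ (2 + s) + 2 ^ s) < 2 ^ (4 + s)
13*2^<2^4+ s = 2^+<2^suc (3 + s) (2^+<2^suc (2 + s) (2^<2^2+ s))

-- The greedy factorization of Tm
blocks : ℕ → List Piece
blocks zero = []
blocks (suc s) = oneZeros (13 * 2 ^ s) ∷ blocks s

oneOrEmpty-blocks : ∀ s → OneOrEmpty (text (blocks s))
oneOrEmpty-blocks zero = inj₁ refl
oneOrEmpty-blocks (suc s) = inj₂ (_ , refl)

Tm : ℕ → Str
Tm m = text (blocks (suc m))

opening : ℕ → List Piece → List Piece
opening c r = oneZeros 0 ∷ zeros 1 ∷ geometric 1 c ++ r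

text-take-opening : ∀ {i c} r → i ≤ c → text (take (suc i) (zeros 1 ∷ geometric 1 c ++ r)) ≡ 0^ (2 ^ i)
text-take-opening {i} r i≤c = trans (text-take-geometric 1 r i≤c) (cong 0^_ (*-identityʳ (2 ^ i)))

suc-<-length-opening : ∀ {i c} r → i ≤ c → suc i < length (opening c r)
suc-<-length-opening {i} {c} r i≤c =
  s≤s (s≤s (subst (i ≤_) (sym (trans (length-++ (geometric 1 c)) (cong (_+ length r) (length-geometric 1 c))))
                  (≤-trans i≤c (m≤m+n c (length r)))))

copyFactor-opening : ∀ {i c} r → i ≤ c → CopyFactor (factors (opening c r)) (0^ (2 ^ i))
copyFactor-opening {i} {c} r i≤c =
  subst (CopyFactor _) (text-take-opening r i≤c)
    (copyFactor-pieces (opening c r) 1 i (suc-<-length-opening r i≤c))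

copyFactor-opening₁ : ∀ {i c} r → i ≤ c → CopyFactor (factors (opening c r)) (true ∷ 0^ (2 ^ i))
copyFactor-opening₁ {i} {c} r i≤c =
  subst (CopyFactor _) (cong (true ∷_) (text-take-opening r i≤c))
    (copyFactor-pieces (opening c r) 0 (suc i) (suc-<-length-opening r i≤c))

all-tails-opening : ∀ {P : List Piece → Set} c r → P (opening c r) → P (zeros 1 ∷ geometric 1 c ++ r)
                  → (∀ c' i' → P (geometric (2 ^ i') (suc c') ++ r)) → All P (tails r) → All P (tails (opening c r))
all-tails-opening c r p₀ p₁ each rest = p₀ ∷ p₁ ∷ all-tails-geometric c 0 each rest

opening-snoc : ∀ c r p → opening c r ++ [ p ] ≡ opening c (r ++ [ p ])
opening-snoc c r p = cong (λ t → oneZeros 0 ∷ zeros 1 ∷ t) (++-assoc (geometric 1 c) r [ p ])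

blockSplitZeros : ℕ → List Piece
blockSplitZeros s = zeros (2 ^ (2 + s)) ∷ zeros (2 ^ s) ∷ []

blockSplit : ℕ → List Piece
blockSplit s = oneZeros (2 ^ (3 + s)) ∷ blockSplitZeros s

-- The greedy factors once the first block and the blocks ss are done, followed by the part y of the current block.
greedyState : ℕ → List ℕ → List Piece → List Piece
greedyState S ss y = opening (3 + S) (blockSplitZeros S ++ concatMap blockSplit ss ++ y)

OneZerosFirst : List Piece → Set
OneZerosFirst r = r ≡ [] ⊎ ∃₂ λ k r' → r ≡ oneZeros k ∷ r'

SplitSuffixes : (List Piece → Set) → ℕ → Set
SplitSuffixes P s = ∀ {r} → OneZerosFirst r → P (blockSplit s ++ r) × P (blockSplitZeros s ++ r) × P (zeros (2 ^ s) ∷ r)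

all-tails-splits : ∀ {P : List Piece → Set} ss {y} → All (SplitSuffixes P) ss → OneZerosFirst y → All P (tails y)
                 → All P (tails (concatMap blockSplit ss ++ y))
all-tails-splits [] [] _ rest = rest
all-tails-splits {P} (s ∷ ss) {y} (split ∷ splits) oy rest with split (oneZerosFirst ss)
  where
  oneZerosFirst : ∀ ss → OneZerosFirst (concatMap blockSplit ss ++ y)
  oneZerosFirst [] = oy
  oneZerosFirst (_ ∷ _) = inj₂ (_ , _ , refl)
... | p₀ , p₁ , p₂ = p₀ ∷ p₁ ∷ p₂ ∷ all-tails-splits ss splits oy rest

capped₁-block₈ : ∀ {S s ss} → s < S → All (s <_) ss
          → All (Capped₁ (2 ^ (3 + s)) (2 ^ (3 + s) + (2 ^ (2 + s) + 2 ^ s))) (tails (greedyState S ss []))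
capped₁-block₈ {S} {s} {ss} s<S s<ss =
  all-tails-opening (3 + S) r ((λ _ → z≤n) , run) (s≤s z≤n) (λ _ i → 1≤2^ i)
    (1≤2^ (2 + S) ∷ 1≤2^ S ∷ all-tails-splits ss (All.map split s<ss) (inj₁ refl) (tt ∷ []))
  where
  r = blockSplitZeros S ++ concatMap blockSplit ss ++ []
  x<2^ : ∀ {t} → s < t → 2 ^ (3 + s) + (2 ^ (2 + s) + 2 ^ s) < 2 ^ (3 + t)
  x<2^ s<t = <-≤-trans (13*2^<2^4+ s) (^-monoʳ-≤ 2 (+-monoʳ-≤ 3 s<t))
  run = capped-geometric (λ i a → a ≡ 2 ^ i)
          (λ { {i} refl → 2^-avoidsGap (3 + s) i (2^+<2^suc (2 + s) (2^<2^2+ s)) , sym (2^suc≡2^+2^ i) })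
          (3 + S) 0 refl (λ { refl → capped-beyond r (x<2^ (subst (s <_) (sym (+-identityʳ S)) s<S)) })
  split : ∀ {t} → s < t → SplitSuffixes (Capped₁ _ _) t
  split {t} s<t _ = capped-beyond (blockSplitZeros t ++ _) (x<2^ s<t) , 1≤2^ (2 + t) , 1≤2^ t

capped₀-opening₄ : ∀ s c r
  → (∀ {a} → AvoidsGap (2 ^ (2 + s)) (2 ^ (2 + s) + 2 ^ s) a → Capped (2 ^ (2 + s)) (2 ^ (2 + s) + 2 ^ s) a r)
          → All (Capped₀ (2 ^ (2 + s)) (2 ^ (2 + s) + 2 ^ s)) (tails r)
          → All (Capped₀ (2 ^ (2 + s)) (2 ^ (2 + s) + 2 ^ s)) (tails (opening c r))
capped₀-opening₄ s c r end rest =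
  all-tails-opening c r tt ((λ _ → z≤n) , run c 0 (≤-refl , inj₂ (s≤s z≤n)) (λ _ → 1≤2^ (2 + s)))
    (λ c' i → run (suc c') i (z≤n , inj₁ refl) (λ _ → z≤n)) rest
  where
  run : ∀ c i {acc} → HalfFull i acc → AvoidsGap _ _ acc → Capped _ _ acc (geometric (2 ^ i) c ++ r)
  run c i half gap = capped-geometric (λ i a → HalfFull i a × AvoidsGap _ _ a)
    (λ {i} {a} (half , gap) → gap , halfFull-step {i} {a} half , halfFull-avoidsGap s {i} {a} half) c i (half , gap) (end ∘ proj₂)

capped₀-power₄ : ∀ s t {r} → OneZerosFirst r → Capped₀ (2 ^ (2 + s)) (2 ^ (2 + s) + 2 ^ s) (zeros (2 ^ t) ∷ r)
capped₀-power₄ s t (inj₁ refl) = (λ _ → z≤n) , 2^-avoidsGap (2 + s) t (2^<2^2+ s)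
capped₀-power₄ s t (inj₂ (_ , _ , refl)) =
  (λ _ → z≤n) , 2^-avoidsGap (2 + s) t (2^<2^2+ s) , 2^≢2^+ (2 + s) t (1≤2^ s) (2^<2^2+ s)

capped₀-block₄ : ∀ {S s ss} → s < S → All (s <_) ss
  → All (Capped₀ (2 ^ (2 + s)) (2 ^ (2 + s) + 2 ^ s)) (tails (greedyState S ss [ oneZeros (2 ^ (3 + s)) ]))
capped₀-block₄ {S} {s} {ss} s<S s<ss =
  capped₀-opening₄ s (3 + S) (blockSplitZeros S ++ R)
    (λ {a} gap → gap , capped-beyond (zeros (2 ^ S) ∷ R) (<-≤-trans (x<2^2+ s<S) (m≤n+m _ a)))
    (((λ _ → z≤n) , capped-beyond (zeros (2 ^ S) ∷ R) (x<2^2+ s<S))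
     ∷ capped₀-power₄ s S (oneZerosFirst ss)
     ∷ all-tails-splits ss (All.map split s<ss) (inj₂ (_ , _ , refl)) (tt ∷ tt ∷ []))
  where
  R = concatMap blockSplit ss ++ [ oneZeros (2 ^ (3 + s)) ]
  x<2^2+ : ∀ {t} → s < t → 2 ^ (2 + s) + 2 ^ s < 2 ^ (2 + t)
  x<2^2+ s<t = <-≤-trans (2^+<2^suc (2 + s) (2^<2^2+ s)) (^-monoʳ-≤ 2 (+-monoʳ-≤ 2 s<t))
  oneZerosFirst : ∀ ss → OneZerosFirst (concatMap blockSplit ss ++ [ oneZeros (2 ^ (3 + s)) ])
  oneZerosFirst [] = inj₂ (_ , _ , refl)
  oneZerosFirst (_ ∷ _) = inj₂ (_ , _ , refl)
  split : ∀ {t} → s < t → SplitSuffixes (Capped₀ _ _) t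
  split {t} s<t {r} oz = tt , ((λ _ → z≤n) , capped-beyond (zeros (2 ^ t) ∷ r) (x<2^2+ s<t)) , capped₀-power₄ s t oz

capped₀-opening-≤ : ∀ {f x} c r → x ≤ f → (∀ a → Capped f x a r)
                  → All (Capped₀ f x) (tails r) → All (Capped₀ f x) (tails (opening c r))
capped₀-opening-≤ {f} {x} c r x≤f end rest =
  all-tails-opening c r tt (avoidsGap-≤ x≤f , run c 0) (λ c' i → run (suc c') i) rest
  where
  run : ∀ c i {acc} → Capped f x acc (geometric (2 ^ i) c ++ r)
  run c i = capped-geometric (λ _ _ → ⊤) (λ _ → avoidsGap-≤ x≤f , tt) c i tt (λ _ → end _)

capped₀-block₁ : ∀ {S s ss} → s < S → All (s <_) ss
  → All (Capped₀ (2 ^ s) (2 ^ s + 0)) (tails (greedyState S ss (oneZeros (2 ^ (3 + s)) ∷ zeros (2 ^ (2 + s)) ∷ [])))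
capped₀-block₁ {S} {s} {ss} s<S s<ss =
  capped₀-opening-≤ (3 + S) (blockSplitZeros S ++ R) x≤f
    (λ a → avoidsGap-≤ x≤f , capped-zeros R x≤f (<-≤-trans (x<2^ s<S) (m≤n+m _ _)))
    (capped-zeros (zeros (2 ^ S) ∷ R) x≤f (x<2^ (<-≤-trans s<S (m≤n+m S 2))) ∷ capped-zeros R x≤f (x<2^ s<S)
     ∷ all-tails-splits ss (All.map split s<ss) (inj₂ (_ , _ , refl))
         (tt ∷ (avoidsGap-≤ x≤f , avoidsGap-≤ x≤f) ∷ tt ∷ []))
  where
  R = concatMap blockSplit ss ++ oneZeros (2 ^ (3 + s)) ∷ zeros (2 ^ (2 + s)) ∷ []
  x≤f = ≤-reflexive (+-identityʳ (2 ^ s))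
  x<2^ : ∀ {t} → s < t → 2 ^ s + 0 < 2 ^ t
  x<2^ s<t = subst (_< _) (sym (+-identityʳ _)) (2^-mono-< s<t)
  split : ∀ {t} → s < t → SplitSuffixes (Capped₀ _ _) t
  split {t} s<t {r} _ =
    tt , capped-zeros (zeros (2 ^ t) ∷ r) x≤f (x<2^ (<-≤-trans s<t (m≤n+m t 2))) , capped-zeros r x≤f (x<2^ s<t)

greedyState-snoc : ∀ S ss y p → greedyState S ss y ++ [ p ] ≡ greedyState S ss (y ++ [ p ])
greedyState-snoc S ss y p = trans (opening-snoc (3 + S) _ p)
  (cong (λ t → opening (3 + S) (blockSplitZeros S ++ t)) (++-assoc (concatMap blockSplit ss) y [ p ]))

greedyState-next : ∀ S ss s → greedyState S ss (blockSplit s) ≡ greedyState S (ss ++ [ s ]) []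
greedyState-next S ss s = cong (λ t → opening (3 + S) (blockSplitZeros S ++ t))
  (sym (trans (++-identityʳ _) (concatMap-++ blockSplit ss [ s ])))

greedyLength-≡ : ∀ {ps qs rem k} → ps ≡ qs → GreedyLength (factors qs) rem k → GreedyLength (factors ps) rem k
greedyLength-≡ refl run = run

greedyLength-block : ∀ {S s ss k} → s < S → All (s <_) ss
  → GreedyLength (factors (greedyState S (ss ++ [ s ]) [])) (text (blocks s)) k
  → GreedyLength (factors (greedyState S ss [])) (text (blocks (suc s))) (3 + k)
greedyLength-block {S} {s} {ss} {k} s<S s<ss run =
  subst (λ n → GreedyLength (factors (greedyState S ss [])) (true ∷ 0^ n ++ z) (3 + k)) (sym (13*2^≡ s)) step₈
  where
  z = text (blocks s)
  oz = oneOrEmpty-blocks s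
  step₁ : GreedyLength (factors (greedyState S ss (oneZeros (2 ^ (3 + s)) ∷ zeros (2 ^ (2 + s)) ∷ []))) (0^ (2 ^ s) ++ z) (1 + k)
  step₁ = greedyLength-zeros (1≤2^ s) refl (copyFactor-opening {s} _ (≤-trans (<⇒≤ s<S) (m≤n+m S 3)))
    (All.map (capped₀⇒bounded-0^ oz (1≤2^ s)) (capped₀-block₁ s<S s<ss))
    (greedyLength-≡ (trans (greedyState-snoc S ss _ _) (greedyState-next S ss s)) run)
  step₄ : GreedyLength (factors (greedyState S ss [ oneZeros (2 ^ (3 + s)) ])) (0^ (2 ^ (2 + s) + 2 ^ s) ++ z) (2 + k)
  step₄ = subst (λ w → GreedyLength (factors (greedyState S ss [ oneZeros (2 ^ (3 + s)) ])) w (2 + k))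
                (0^-++ (2 ^ (2 + s)) (2 ^ s) z)
    (greedyLength-zeros (1≤2^ (2 + s)) refl (copyFactor-opening {2 + s} _ (≤-trans (+-monoʳ-≤ 2 (<⇒≤ s<S)) (n≤1+n _)))
      (All.map (capped₀⇒bounded-0^ oz (1≤2^ (2 + s))) (capped₀-block₄ s<S s<ss))
      (greedyLength-≡ (greedyState-snoc S ss _ _) step₁))
  step₈ : GreedyLength (factors (greedyState S ss [])) (true ∷ 0^ (2 ^ (3 + s) + (2 ^ (2 + s) + 2 ^ s)) ++ z) (3 + k)
  step₈ = subst (λ w → GreedyLength (factors (greedyState S ss [])) (true ∷ w) (3 + k)) (0^-++ (2 ^ (3 + s)) _ z)
    (greedyLength-oneZeros refl (copyFactor-opening₁ {3 + s} _ (+-monoʳ-≤ 3 (<⇒≤ s<S)))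
      (All.map (capped₁⇒bounded-0^ oz) (capped₁-block₈ s<S s<ss))
      (greedyLength-≡ (greedyState-snoc S ss [] _) step₄))

greedyLength-blocks : ∀ {S} n → n ≤ S → ∀ {ss} → All (n ≤_) ss
                    → GreedyLength (factors (greedyState S ss [])) (text (blocks n)) (3 * n)
greedyLength-blocks zero _ _ = greedyLength-[]
greedyLength-blocks (suc n) n<S n<ss =
  subst (GreedyLength _ _) (sym (*-suc 3 n))
    (greedyLength-block n<S n<ss (greedyLength-blocks n (<⇒≤ n<S) (All.++⁺ (All.map <⇒≤ n<ss) (≤-refl ∷ []))))

greedyLength-firstBlock : ∀ S
  → GreedyLength (factors (opening (3 + S) [])) (0^ (2 ^ (2 + S)) ++ 0^ (2 ^ S) ++ text (blocks S)) (2 + 3 * S)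
greedyLength-firstBlock S =
  greedyLength-zeros (1≤2^ (2 + S)) refl (copyFactor-opening {2 + S} [] (n≤1+n _))
    (All.map (capped₀⇒bounded-0^ oz (1≤2^ (2 + S))) (capped₀-opening₄ S (3 + S) [] (λ gap → gap) (tt ∷ [])))
    (greedyLength-≡ (opening-snoc (3 + S) [] _)
      (greedyLength-zeros (1≤2^ S) refl (copyFactor-opening {S} [ zeros (2 ^ (2 + S)) ] (m≤n+m S 3))
        (All.map (capped₀⇒bounded-0^ oz (1≤2^ S))
          (capped₀-opening-≤ (3 + S) [ zeros (2 ^ (2 + S)) ] x≤f (λ _ → avoidsGap-≤ x≤f , avoidsGap-≤ x≤f)
            ((avoidsGap-≤ x≤f , avoidsGap-≤ x≤f) ∷ tt ∷ [])))
        (greedyLength-≡ (opening-snoc (3 + S) _ _)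
          (greedyLength-blocks S ≤-refl []))))
  where
  oz = oneOrEmpty-blocks S
  x≤f = ≤-reflexive (+-identityʳ (2 ^ S))

opening-prefixesBounded : ∀ j rem → All (PrefixesBounded (0^ (2 ^ j) ++ rem) (2 ^ j)) (tails (opening j []))
opening-prefixesBounded j rem =
  startsWithOne (2 ^ j) (1≤2^ j)
  ∷ subst (λ b → All (PrefixesBounded (0^ (2 ^ j) ++ rem) b) (tails (zeros 1 ∷ geometric 1 j ++ [])))
      (trans (cong length zeroRun) (length-replicate (2 ^ j)))
      (prefixesBounded-total (0^ (2 ^ j) ++ rem) (zeros 1 ∷ geometric 1 j ++ []))
  where
  zeroRun : text (zeros 1 ∷ geometric 1 j ++ []) ≡ 0^ (2 ^ j)
  zeroRun = trans (cong (λ ps → text (zeros 1 ∷ ps)) (++-identityʳ (geometric 1 j)))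
                  (trans (text-geometric 1 j) (cong 0^_ (*-identityʳ _)))
  startsWithOne : ∀ f → 1 ≤ f → PrefixesBounded (0^ f ++ rem) f (opening j [])
  startsWithOne f _ zero _ = z≤n
  startsWithOne (suc f) _ (suc n) (_ , ())

greedyLength-doubling : ∀ c j w {k} → GreedyLength (factors (opening (c + j) [])) w k
                      → GreedyLength (factors (opening j [])) (text (geometric (2 ^ j) c) ++ w) (c + k)
greedyLength-doubling zero j w run = run
greedyLength-doubling (suc c) j w {k} run =
  subst (λ w' → GreedyLength (factors (opening j [])) w' _) (sym (++-assoc (0^ (2 ^ j)) _ w))
    (greedyLength-zeros (1≤2^ j) refl (copyFactor-opening {j} [] ≤-refl) (opening-prefixesBounded j _)
      (greedyLength-≡ (trans (opening-snoc j [] _) (cong (λ ps → oneZeros 0 ∷ zeros 1 ∷ ps) doubled))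
        (greedyLength-doubling c (suc j) w (subst (λ i → GreedyLength (factors (opening i [])) w k) (sym (+-suc c j)) run))))
  where
  doubled : geometric 1 j ++ [ zeros (2 ^ j) ] ≡ geometric 1 (suc j) ++ []
  doubled = trans (geometric-snoc 1 j (sym (*-identityʳ _))) (sym (++-identityʳ _))

Tm≡opening : ∀ S → Tm S ≡ true ∷ false ∷ text (geometric 1 (3 + S)) ++ 0^ (2 ^ (2 + S)) ++ 0^ (2 ^ S) ++ text (blocks S)
Tm≡opening S = begin
  true ∷ 0^ (13 * 2 ^ S) ++ z
    ≡⟨ cong (λ n → true ∷ 0^ n ++ z) (13*2^≡ S) ⟩
  true ∷ 0^ (2 ^ (3 + S) + (2 ^ (2 + S) + 2 ^ S)) ++ z
    ≡⟨ cong (true ∷_) (sym (0^-++ (2 ^ (3 + S)) _ z)) ⟩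
  true ∷ 0^ (2 ^ (3 + S)) ++ 0^ (2 ^ (2 + S) + 2 ^ S) ++ z
    ≡⟨ cong (λ w → true ∷ 0^ (2 ^ (3 + S)) ++ w) (sym (0^-++ (2 ^ (2 + S)) (2 ^ S) z)) ⟩
  true ∷ 0^ (2 ^ (3 + S)) ++ 0^ (2 ^ (2 + S)) ++ 0^ (2 ^ S) ++ z
    ≡⟨ cong (λ u → true ∷ u ++ 0^ (2 ^ (2 + S)) ++ 0^ (2 ^ S) ++ z) (sym zeroRun) ⟩
  true ∷ false ∷ text (geometric 1 (3 + S)) ++ 0^ (2 ^ (2 + S)) ++ 0^ (2 ^ S) ++ z
    ∎
  where
  open ≡-Reasoning
  z = text (blocks S)
  zeroRun : false ∷ text (geometric 1 (3 + S)) ≡ 0^ (2 ^ (3 + S))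
  zeroRun = trans (text-geometric 1 (3 + S)) (cong 0^_ (*-identityʳ _))

greedyLength-Tm : ∀ S → GreedyLength [] (Tm S) (2 + (3 + S + (2 + 3 * S)))
greedyLength-Tm S =
  subst (λ w → GreedyLength [] w (2 + (3 + S + (2 + 3 * S)))) (sym (Tm≡opening S))
    (greedyLength-char refl (greedyLength-char refl
      (greedyLength-doubling (3 + S) 0 _
        (greedyLength-≡ (cong (λ c → opening c []) (+-identityʳ (3 + S))) (greedyLength-firstBlock S)))))

length-greedy-Tm : ∀ m → length (greedy (Tm m)) ≡ 7 + 4 * m
length-greedy-Tm m = trans (factorCount (greedyLength-Tm m) (length (Tm m)) ≤-refl) (count m)
  where
  count : ∀ m → 2 + (3 + m + (2 + 3 * m)) ≡ 7 + 4 * m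
  count = solve-∀

-- A factorization of Tm with 2m + 7 factors
seed : List Piece
seed = oneZeros 0 ∷ zeros 1 ∷ zeros 1 ∷ zeros 1 ∷ zeros 3 ∷ zeros 6 ∷ zeros 1 ∷ []

goodState : ℕ → List Piece → List Piece
goodState t B = seed ++ geometric 13 t ++ B

length-goodState : ∀ t B → length (goodState t B) ≡ 7 + (t + length B)
length-goodState t B = cong (7 +_) (trans (length-++ (geometric 13 t)) (cong (_+ length B) (length-geometric 13 t)))

text-take-goodState : ∀ {i t} B → i ≤ t → text (take (6 + i) (drop 1 (goodState t B))) ≡ 0^ (2 ^ i * 13)
text-take-goodState B i≤t = text-take-geometric 13 B i≤t

lz-piece : ∀ {ps Fs} p → NonEmpty ⟦ p ⟧ → CharFactor (factors ps) ⟦ p ⟧ ⊎ CopyFactor (factors ps) ⟦ p ⟧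
         → LZ (factors (ps ++ [ p ])) Fs → LZ (factors ps) (⟦ p ⟧ ∷ Fs)
lz-piece {ps} {Fs} p nonEmpty valid lz = next nonEmpty valid (subst (λ prev → LZ prev Fs) (map-++ ⟦_⟧ ps [ p ]) lz)

nonEmpty-0^ : ∀ {n} → 1 ≤ n → NonEmpty (0^ n)
nonEmpty-0^ {suc n} _ = false , 0^ n , refl

lz-geometric : ∀ c t {a B} → a ≡ 2 ^ t * 13 → LZ (factors (goodState (c + t) [])) (factors B)
             → LZ (factors (goodState t [])) (factors (geometric a c ++ B))
lz-geometric zero t _ lz = lz
lz-geometric (suc c) t {B = B} refl lz =
  lz-piece {goodState t []} (zeros (2 ^ t * 13)) (nonEmpty-0^ (*-mono-≤ (1≤2^ t) (s≤s z≤n)))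
    (inj₂ (subst (CopyFactor (factors (goodState t []))) (text-take-goodState {t} [] ≤-refl)
            (copyFactor-pieces (goodState t []) 1 (5 + t)
              (≤-reflexive (sym (trans (length-goodState t []) (cong (7 +_) (+-identityʳ t))))))))
    (subst (λ ps → LZ (factors ps) (factors (geometric (2 * (2 ^ t * 13)) c ++ B))) (sym grown)
      (lz-geometric c (suc t) (sym (*-assoc 2 (2 ^ t) 13))
        (subst (λ i → LZ (factors (goodState i [])) (factors B)) (sym (+-suc c t)) lz)))
  where
  grown : goodState t [] ++ [ zeros (2 ^ t * 13) ] ≡ goodState (suc t) []
  grown = cong (seed ++_) (trans (cong (_++ [ zeros (2 ^ t * 13) ]) (++-identityʳ (geometric 13 t)))
                                  (trans (geometric-snoc 13 t refl) (sym (++-identityʳ (geometric 13 (suc t))))))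

lz-blocks : ∀ {m} s B → s ≤ m → LZ (factors (goodState m B)) (factors (blocks s))
lz-blocks zero B _ = done
lz-blocks {m} (suc s) B s<m =
  lz-piece {goodState m B} block (true , _ , refl)
    (inj₂ (subst (λ n → CopyFactor (factors (goodState m B)) (true ∷ 0^ n)) (*-comm (2 ^ s) 13)
            (subst (CopyFactor (factors (goodState m B))) (cong (true ∷_) (text-take-goodState B (<⇒≤ s<m)))
              (copyFactor-pieces (goodState m B) 0 (6 + s)
                (subst (7 + s ≤_) (sym (length-goodState m B)) (+-monoʳ-≤ 7 (≤-trans (<⇒≤ s<m) (m≤m+n m _))))))))
    (subst (λ ps → LZ (factors ps) (factors (blocks s))) (sym (cong (seed ++_) (++-assoc (geometric 13 m) B [ block ])))
      (lz-blocks s (B ++ [ block ]) (<⇒≤ s<m)))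
  where block = oneZeros (13 * 2 ^ s)

goodPieces : ℕ → List Piece
goodPieces m = goodState m (blocks m)

text-goodPieces : ∀ m → text (goodPieces m) ≡ Tm m
text-goodPieces m = begin
  true ∷ 0^ 13 ++ text (geometric 13 m ++ blocks m)   ≡⟨ cong (λ w → true ∷ 0^ 13 ++ w) (text-++ (geometric 13 m) (blocks m)) ⟩
  true ∷ 0^ 13 ++ text (geometric 13 m) ++ z          ≡⟨ cong (true ∷_) (sym (++-assoc (0^ 13) _ z)) ⟩
  true ∷ (0^ 13 ++ text (geometric 13 m)) ++ z        ≡⟨ cong (λ u → true ∷ u ++ z) (text-geometric 13 m) ⟩
  true ∷ 0^ (2 ^ m * 13) ++ z                         ≡⟨ cong (λ n → true ∷ 0^ n ++ z) (*-comm (2 ^ m) 13) ⟩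
  true ∷ 0^ (13 * 2 ^ m) ++ z                         ∎
  where
  open ≡-Reasoning
  z = text (blocks m)

lz-goodPieces : ∀ m → LZ [] (factors (goodPieces m))
lz-goodPieces m =
  next (true , [] , refl) (inj₁ (true , refl , λ ()))
  (next (false , [] , refl) (inj₁ (false , refl , λ { (here ()) ; (there ()) }))
  (next (false , [] , refl) (inj₂ (1 , 1 , s≤s z≤n , s≤s (s≤s z≤n) , refl))
  (next (false , [] , refl) (inj₂ (1 , 1 , s≤s z≤n , s≤s (s≤s z≤n) , refl))
  (next (false , _ , refl) (inj₂ (1 , 3 , s≤s z≤n , ≤-refl , refl))
  (next (false , _ , refl) (inj₂ (1 , 4 , s≤s z≤n , ≤-refl , refl))
  (next (false , [] , refl) (inj₂ (1 , 1 , s≤s z≤n , s≤s (s≤s z≤n) , refl))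
  (lz-geometric m 0 refl
    (subst (λ t → LZ (factors (goodState t [])) (factors (blocks m))) (sym (+-identityʳ m)) (lz-blocks m [] ≤-refl)))))))))

length-goodPieces : ∀ m → length (factors (goodPieces m)) ≡ 7 + 2 * m
length-goodPieces m =
  trans (length-map ⟦_⟧ (goodPieces m))
    (trans (length-goodState m (blocks m)) (cong (λ n → 7 + (m + n)) (trans (length-blocks m) (sym (+-identityʳ m)))))
  where
  length-blocks : ∀ s → length (blocks s) ≡ s
  length-blocks zero = refl
  length-blocks (suc s) = cong suc (length-blocks s)

ratioTendsTo2-cong : ∀ {a a' b b'} → (∀ m → a m ≡ a' m) → (∀ m → b m ≡ b' m)
                   → RatioTendsTo2 a' b' → RatioTendsTo2 a b
ratioTendsTo2-cong {a} {a'} {b} {b'} a≡ b≡ lim k 1≤k with lim k 1≤k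
... | N , close = N , λ m N≤m →
  subst₂ (λ x y → ∣ k * x - 2 * k * y ∣ < y) (sym (a≡ m)) (sym (b≡ m)) (close m N≤m)

affine-ratioTendsTo2 : ∀ g → RatioTendsTo2 (λ m → g + 4 * m) (λ m → g + 2 * m)
affine-ratioTendsTo2 g k _ = suc (k * g) , λ m kg<m → begin-strict
  ∣ k * (g + 4 * m) - 2 * k * (g + 2 * m) ∣            ≡⟨ cong (λ y → ∣ k * (g + 4 * m) - y ∣) (twice k g m) ⟩
  ∣ k * (g + 4 * m) - (k * (g + 4 * m) + k * g) ∣      ≡⟨ ∣m-m+n∣≡n (k * (g + 4 * m)) (k * g) ⟩
  k * g                                                <⟨ kg<m ⟩
  m                                                    ≤⟨ m≤m+n m (m + 0) ⟩
  2 * m                                                ≤⟨ m≤n+m (2 * m) g ⟩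
  g + 2 * m                                            ∎
  where
  open ≤-Reasoning
  twice : ∀ k g m → 2 * k * (g + 2 * m) ≡ k * (g + 4 * m) + k * g
  twice = solve-∀

mainTheorem10 : Σ (ℕ → Str) λ T → Σ (ℕ → Fact) λ G → ((m : ℕ) → 2 ≤ m → IsLZSE (T m) (G m)) × RatioTendsTo2 (λ m → length (greedy (T m))) (λ m → length (G m))
mainTheorem10 =
  Tm , (λ m → factors (goodPieces m)) , (λ m _ → text-goodPieces m , lz-goodPieces m) ,
  ratioTendsTo2-cong length-greedy-Tm length-goodPieces (affine-ratioTendsTo2 7)
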